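{- Let $\Pi$ be any epistemic program (a set of rules as defined in the context). A belief view $\mathcal{W}$ (a set of propositional interpretations) is an equilibrium world view of $\Pi$ if and only if $\mathcal{W}$ is a G91-world view of $\Pi$ and $\mathcal{W}$ is founded with respect to $\Pi$.
   Context: Fix a set $\mathrm{At}$ of atoms. Formulas: $\varphi ::= \bot \mid a \mid \varphi_1\wedge\varphi_2 \mid \varphi_1\vee\varphi_2\mid \varphi_1\to\varphi_2 \mid \mathbf{L}\varphi$ ($a\in\mathrm{At}$); $\neg\varphi := \varphi\to\bot$, $\top:=\neg\bot$, $\varphi\leftarrow\psi := \psi\to\varphi$. A theory is a set of formulas. Classical/KD45 part. A propositional interpretation is a set $I\subseteq\mathrm{At}$. A belief view $\mathcal{W}$ is a set of propositional interpretations. Satisfaction $\langle\mathcal{W},I\rangle\models\varphi$ is classical for $\bot,\wedge,\vee,\to$ (with $\langle\mathcal W,I\rangle\models a$ iff $a\in I$), and $\langle\mathcal{W},I\rangle\models\mathbf{L}\psi$ iff $\langle\mathcal{W},J\rangle\models\psi$ for all $J\in\mathcal{W}$. Write $\mathcal W\models\mathbf L\psi$ when this holds. The subjective reduct $\Gamma^{\mathcal W}$ of a theory $\Gamma$ replaces every maximal subformula $\mathbf{L}\psi$ by $\top$ if $\mathcal{W}\models\mathbf{L}\psi$ and by $\bot$ otherwise. Here-and-There (HT). An HT-interpretation is a pair $\langle H,T\rangle$ with $H\subseteq T\subseteq\mathrm{At}$; for $\mathbf L$-free formulas: $\langle H,T\rangle\not\models\bot$; $\langle H,T\rangle\models p$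 iff $p\in H$; $\wedge,\vee$ componentwise; $\langle H,T\rangle\models\varphi\to\psi$ iff $T\models\varphi\to\psi$ classically and ($\langle H,T\rangle\not\models\varphi$ or $\langle H,T\rangle\models\psi$). $T$ is a stable model of an $\mathbf L$-free theory $\Gamma$ iff $T\models\Gamma$ classically and there is no $H\subsetneq T$ with $\langle H,T\rangle\models\Gamma$; $\mathrm{SM}[\Gamma]$ is the set of stable models. $\mathcal W$ is a G91-world view of $\Gamma$ iff $\mathcal{W}=\mathrm{SM}[\Gamma^{\mathcal W}]$. Programs. An objective literal is $a$, $\neg a$ or $\neg\neg a$ ($a\in\mathrm{At}$); a subjective literal is $\mathbf L l$, $\neg\mathbf L l$ or $\neg\neg\mathbf L l$ with $l$ an objective literal; a literal is positive if it contains no negation. A rule is $a_1\vee\dots\vee a_n\leftarrow B_1\wedge\dots\wedge B_m$ ($n,m\ge0$, $n+m>0$, $a_i$ atoms, $B_j$ literals); $\mathrm{Head}(r)=\{a_1,\dots,a_n\}$ (the formula $\bot$ if $n=0$), $\mathrm{Body}(r)=B_1\wedge\dots\wedge B_m$ ($\top$ if $m=0$); $\mathrm{Body}^+_{ob}(r)$ is the set of atoms $a$ such that $a$ is one of the $B_j$; $\mathrm{Body}^+_{sub}(r)$ is the set of atoms $a$ such that $\mathbf L a$ is one of the $B_j$. A program is a set of rules. Foundedness. Given program $\Pi$ and belief view $\mathcal W$, an unfounded set is a non-empty set $\mathcal U$ of pairs $\langle X,I\rangle$ of sets of atoms such that, letting $Y=\bigcup\{X' : \langle X',I'\rangle\in\mathcal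 U\}$, for every $\langle X,I\rangle\in\mathcal U$ there is no rule $r\in\Pi$ with $\mathrm{Head}(r)\cap X\neq\emptyset$ satisfying all of: (1) $\langle\mathcal W,I\rangle\models\mathrm{Body}(r)$; (2) $\mathrm{Body}^+_{ob}(r)\cap X=\emptyset$; (3) $(\mathrm{Head}(r)\setminus X)\cap I=\emptyset$; (4) $\mathrm{Body}^+_{sub}(r)\cap Y=\emptyset$. $\mathcal W$ is unfounded (w.r.t. $\Pi$) if there is an unfounded set $\mathcal U$ such that every $\langle X,I\rangle\in\mathcal U$ has $I\in\mathcal W$ and $X\cap I\neq\emptyset$; otherwise $\mathcal W$ is founded. FAEEL. An HT belief view is a non-empty set $\mathcal W$ of HT-interpretations; $\mathcal W^t=\{T_i:\langle H_i,T_i\rangle\in\mathcal W\}$; $\mathcal W$ is total if $H_i=T_i$ for all members (identified with a set of interpretations). For a belief interpretation $\mathcal I=\langle \mathcal W,H,T\rangle$ ($H\subseteq T$): $\mathcal I\not\models\bot$; $\mathcal I\models a$ iff $a\in H$; $\wedge,\vee$ componentwise; $\mathcal I\models\psi_1\to\psi_2$ iff (i) $\mathcal I\not\models\psi_1$ or $\mathcal I\models\psi_2$, and (ii) $\langle\mathcal W^t,T\rangle\not\models\psi_1$ or $\langle\mathcal W^t,T\rangle\models\psi_2$ (the latter being the same definition applied to the total interpretation $\langle\mathcal W^t,T,T\rangle$); $\mathcal I\models\mathbf L\psi$ iff $\langle\mathcal W,H_i,T_i\rangle\models\psi$ for all $\langle H_i,T_i\rangle\in\mathcal W$. $\langle\mathcal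 W,H,T\rangle$ is a belief model of $\Gamma$ iff $\langle\mathcal W,H_i,T_i\rangle\models\varphi$ for all $\varphi\in\Gamma$ and all $\langle H_i,T_i\rangle\in\mathcal W\cup\{\langle H,T\rangle\}$. Order: $\langle\mathcal W',H',T'\rangle\preceq\langle\mathcal W,H,T\rangle$ iff $T'=T$, $H'\subseteq H$, for every $\langle H_i,T_i\rangle\in\mathcal W$ there is $\langle H_i',T_i\rangle\in\mathcal W'$ with $H_i'\subseteq H_i$, and for every $\langle H'_i,T_i\rangle\in\mathcal W'$ there is $\langle H_i,T_i\rangle\in\mathcal W$ with $H'_i\subseteq H_i$; $\prec$ is the strict version. A total belief interpretation $\langle\mathcal W,T,T\rangle$ (written $\langle\mathcal W,T\rangle$) is an equilibrium belief model of $\Gamma$ if it is a belief model of $\Gamma$ and no belief model $\mathcal I'$ of $\Gamma$ satisfies $\mathcal I'\prec\langle\mathcal W,T\rangle$; $\mathrm{EQB}[\Gamma]$ denotes their set. A (total) belief view $\mathcal W$ is an equilibrium world view of $\Gamma$ iff $\mathcal W=\{T : \langle\mathcal W,T\rangle\in\mathrm{EQB}[\Gamma]\}$. -}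

module Defs where

open import Level using (0ℓ)
open import Data.Bool using (Bool; true; false)
open import Data.Nat using (ℕ; _+_; _<_)
open import Data.List using (List; []; _∷_; length)
open import Data.List.Membership.Propositional using (_∈_)
open import Data.Product using (Σ; _×_; _,_; ∃)
open import Data.Sum using (_⊎_)
open import Data.Empty using (⊥)
open import Relation.Nullary using (¬_)
open import Relation.Binary.PropositionalEquality using (_≡_)
open import Function.Bundles using (_⇔_)

module _ {At : Set} where

  data Formula : Set where
    ⊥f   : Formula
    atom : At → Formula
    _∧f_ : Formula → Formula → Formula
    _∨f_ : Formula → Formula → Formula
    _⇒f_ : Formula → Formula → Formula
    𝐋    : Formula → Formula

  ¬f_ : Formula → Formula
  ¬f φ = φ ⇒f ⊥f

  ⊤f : Formula
  ⊤f = ¬f ⊥f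

  data PForm : Set where
    ⊥p   : PForm
    patom : At → PForm
    _∧p_ : PForm → PForm → PForm
    _∨p_ : PForm → PForm → PForm
    _⇒p_ : PForm → PForm → PForm

  ⊤p : PForm
  ⊤p = ⊥p ⇒p ⊥p

  Theory : Set₁
  Theory = Formula → Set

  PTheory : Set₁
  PTheory = PForm → Set

  Interp : Set
  Interp = At → Bool

  _⊆_ : Interp → Interp → Set
  X ⊆ Y = ∀ a → X a ≡ true → Y a ≡ true

  _≐_ : Interp → Interp → Set
  X ≐ Y = ∀ a → X a ≡ Y a

  _⊊_ : Interp → Interp → Set
  X ⊊ Y = X ⊆ Y × (Σ At λ a → Y a ≡ true × X a ≡ false)

  BeliefView : Set₁
  BeliefView = Interp → Set

  NonEmpty : BeliefView → Set
  NonEmpty W = Σ Interp W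

  satC : BeliefView → Interp → Formula → Set
  satC W I ⊥f = ⊥
  satC W I (atom a) = I a ≡ true
  satC W I (φ ∧f ψ) = satC W I φ × satC W I ψ
  satC W I (φ ∨f ψ) = satC W I φ ⊎ satC W I ψ
  satC W I (φ ⇒f ψ) = satC W I φ → satC W I ψ
  satC W I (𝐋 ψ) = ∀ J → W J → satC W J ψ

  _⊨L_ : BeliefView → Formula → Set
  W ⊨L ψ = ∀ J → W J → satC W J ψ

  -- subjective reduct, as a (functional) relation  φ ↦ φ^W
  data IsReduct (W : BeliefView) : Formula → PForm → Set where
    r⊥  : IsReduct W ⊥f ⊥p
    rat : ∀ a → IsReduct W (atom a) (patom a)
    r∧  : ∀ {φ ψ φ' ψ'} → IsReduct W φ φ' → IsReduct W ψ ψ' → IsReduct W (φ ∧f ψ) (φ' ∧p ψ')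
    r∨  : ∀ {φ ψ φ' ψ'} → IsReduct W φ φ' → IsReduct W ψ ψ' → IsReduct W (φ ∨f ψ) (φ' ∨p ψ')
    r⇒  : ∀ {φ ψ φ' ψ'} → IsReduct W φ φ' → IsReduct W ψ ψ' → IsReduct W (φ ⇒f ψ) (φ' ⇒p ψ')
    rL⊤ : ∀ {ψ} → W ⊨L ψ → IsReduct W (𝐋 ψ) ⊤p
    rL⊥ : ∀ {ψ} → ¬ (W ⊨L ψ) → IsReduct W (𝐋 ψ) ⊥p

  Reduct : Theory → BeliefView → PTheory
  Reduct Γ W p = Σ Formula λ φ → Γ φ × IsReduct W φ p

  satP : Interp → PForm → Set
  satP T ⊥p = ⊥
  satP T (patom a) = T a ≡ true
  satP T (p ∧p q) = satP T p × satP T q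
  satP T (p ∨p q) = satP T p ⊎ satP T q
  satP T (p ⇒p q) = satP T p → satP T q

  satHT : Interp → Interp → PForm → Set
  satHT H T ⊥p = ⊥
  satHT H T (patom a) = H a ≡ true
  satHT H T (p ∧p q) = satHT H T p × satHT H T q
  satHT H T (p ∨p q) = satHT H T p ⊎ satHT H T q
  satHT H T (p ⇒p q) = satP T (p ⇒p q) × (satHT H T p → satHT H T q)

  SM : PTheory → Interp → Set
  SM Γ T = (∀ p → Γ p → satP T p)
         × ¬ (Σ Interp λ H → H ⊊ T × (∀ p → Γ p → satHT H T p))

  G91WorldView : Theory → BeliefView → Set
  G91WorldView Γ W = ∀ T → W T ⇔ SM (Reduct Γ W) T

  data ObjLit : Set where
    opos    : At → ObjLit
    oneg    : At → ObjLit
    onegneg : At → ObjLit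

  data Lit : Set where
    obj     : ObjLit → Lit
    subpos  : ObjLit → Lit
    subneg  : ObjLit → Lit
    subnegneg : ObjLit → Lit

  record Rule : Set where
    constructor mkRule
    field
      head : List At
      body : List Lit
  open Rule public

  Program : Set₁
  Program = Rule → Set

  WellFormed : Program → Set
  WellFormed Π = ∀ r → Π r → 0 < length (head r) + length (body r)

  objF : ObjLit → Formula
  objF (opos a) = atom a
  objF (oneg a) = ¬f atom a
  objF (onegneg a) = ¬f (¬f atom a)

  litF : Lit → Formula
  litF (obj l) = objF l
  litF (subpos l) = 𝐋 (objF l)
  litF (subneg l) = ¬f 𝐋 (objF l)
  litF (subnegneg l) = ¬f (¬f 𝐋 (objF l))

  disjF : List At → Formula
  disjF [] = ⊥f
  disjF (a ∷ []) = atom a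
  disjF (a ∷ as@(_ ∷ _)) = atom a ∨f disjF as

  conjF : List Lit → Formula
  conjF [] = ⊤f
  conjF (l ∷ []) = litF l
  conjF (l ∷ ls@(_ ∷ _)) = litF l ∧f conjF ls

  HeadF : Rule → Formula
  HeadF r = disjF (head r)

  BodyF : Rule → Formula
  BodyF r = conjF (body r)

  ruleF : Rule → Formula
  ruleF r = BodyF r ⇒f HeadF r

  theory : Program → Theory
  theory Π φ = Σ Rule λ r → Π r × ruleF r ≡ φ

  _∈Body⁺ob_ : At → Rule → Set
  a ∈Body⁺ob r = obj (opos a) ∈ body r

  _∈Body⁺sub_ : At → Rule → Set
  a ∈Body⁺sub r = subpos (opos a) ∈ body r

  PairSet : Set₁
  PairSet = Interp × Interp → Set

  UnionX : PairSet → At → Set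
  UnionX U a = Σ Interp λ X' → Σ Interp λ I' → U (X' , I') × X' a ≡ true

  Supports : BeliefView → PairSet → Rule → Interp → Interp → Set
  Supports W U r X I =
      (Σ At λ a → a ∈ head r × X a ≡ true)
    × satC W I (BodyF r)
    × (∀ a → a ∈Body⁺ob r → X a ≡ false)
    × (∀ a → a ∈ head r → X a ≡ false → I a ≡ false)
    × (∀ a → a ∈Body⁺sub r → ¬ UnionX U a)

  IsUnfoundedSet : Program → BeliefView → PairSet → Set
  IsUnfoundedSet Π W U =
      Σ (Interp × Interp) U
    × (∀ X I → U (X , I) → ¬ (Σ Rule λ r → Π r × Supports W U r X I))

  Unfounded : Program → BeliefView → Set₁
  Unfounded Π W = Σ PairSet λ U → IsUnfoundedSet Π W U
    × (∀ X I → U (X , I) → W I × (Σ At λ a → X a ≡ true × I a ≡ true))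

  Founded : Program → BeliefView → Set₁
  Founded Π W = ¬ Unfounded Π W

  HTView : Set₁
  HTView = Interp × Interp → Set

  IsHTView : HTView → Set
  IsHTView 𝒱 = Σ (Interp × Interp) 𝒱 × (∀ H T → 𝒱 (H , T) → H ⊆ T)

  tot : HTView → HTView
  tot 𝒱 (X , Y) = Σ Interp (λ H → 𝒱 (H , Y)) × X ≐ Y

  totalView : BeliefView → HTView
  totalView W (X , Y) = W Y × X ≐ Y

  satB : HTView → Interp → Interp → Formula → Set
  satB 𝒱 H T ⊥f = ⊥
  satB 𝒱 H T (atom a) = H a ≡ true
  satB 𝒱 H T (φ ∧f ψ) = satB 𝒱 H T φ × satB 𝒱 H T ψ
  satB 𝒱 H T (φ ∨f ψ) = satB 𝒱 H T φ ⊎ satB 𝒱 H T ψ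
  satB 𝒱 H T (φ ⇒f ψ) = (satB 𝒱 H T φ → satB 𝒱 H T ψ)
                      × (satB (tot 𝒱) T T φ → satB (tot 𝒱) T T ψ)
  satB 𝒱 H T (𝐋 ψ) = ∀ Hᵢ Tᵢ → 𝒱 (Hᵢ , Tᵢ) → satB 𝒱 Hᵢ Tᵢ ψ

  BeliefModel : Theory → HTView → Interp → Interp → Set
  BeliefModel Γ 𝒱 H T = ∀ φ → Γ φ →
    (∀ Hᵢ Tᵢ → 𝒱 (Hᵢ , Tᵢ) → satB 𝒱 Hᵢ Tᵢ φ) × satB 𝒱 H T φ

  Preceq : HTView → Interp → Interp → HTView → Interp → Interp → Set
  Preceq 𝒱' H' T' 𝒱 H T =
      T' ≐ T
    × H' ⊆ H
    × (∀ Hᵢ Tᵢ → 𝒱 (Hᵢ , Tᵢ) → Σ Interp λ Hᵢ' → 𝒱' (Hᵢ' , Tᵢ) × Hᵢ' ⊆ Hᵢ)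
    × (∀ Hᵢ' Tᵢ → 𝒱' (Hᵢ' , Tᵢ) → Σ Interp λ Hᵢ → 𝒱 (Hᵢ , Tᵢ) × Hᵢ' ⊆ Hᵢ)

  _⊑V_ : HTView → HTView → Set
  𝒱 ⊑V 𝒱' = ∀ H T → 𝒱 (H , T) →
    Σ Interp λ H' → Σ Interp λ T' → 𝒱' (H' , T') × H ≐ H' × T ≐ T'

  SameBI : HTView → Interp → Interp → HTView → Interp → Interp → Set
  SameBI 𝒱' H' T' 𝒱 H T = (𝒱' ⊑V 𝒱) × (𝒱 ⊑V 𝒱') × H' ≐ H × T' ≐ T

  Prec : HTView → Interp → Interp → HTView → Interp → Interp → Set
  Prec 𝒱' H' T' 𝒱 H T = Preceq 𝒱' H' T' 𝒱 H T × ¬ SameBI 𝒱' H' T' 𝒱 H T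

  EQB : Theory → BeliefView → Interp → Set₁
  EQB Γ W T = BeliefModel Γ (totalView W) T T
    × ¬ (Σ HTView λ 𝒱' → Σ Interp λ H' → Σ Interp λ T' →
           IsHTView 𝒱' × H' ⊆ T' × BeliefModel Γ 𝒱' H' T'
           × Prec 𝒱' H' T' (totalView W) T T)

  EquilibriumWorldView : Theory → BeliefView → Set₁
  EquilibriumWorldView Γ W = ∀ T → W T ⇔ EQB Γ W T

-- Over the total view of W, FAEEL satisfaction agrees with KD45 satisfaction, and at a point
-- ⟨H , T⟩ it agrees with HT satisfaction of the subjective reduct Γ^W; so the equilibrium points
-- whose competitors keep the view total are exactly the stable models of Γ^W.  The remaining
-- competitors lower the members of the view themselves, and these correspond to unfounded sets:
-- an unfounded set U gives the smaller belief model that adds ⟨I ∖ X , I⟩ for each ⟨X , I⟩ ∈ U,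
-- and conversely the non-total members ⟨Hᵢ , Tᵢ⟩ of a smaller belief model form the unfounded
-- set of the pairs ⟨Tᵢ ∖ Hᵢ , Tᵢ⟩.  Excluded middle decides the reduct and these case splits.
module Submission where

open import Defs
open import Level using (0ℓ; lift; lower)
open import Data.Product using (_×_; _,_; Σ; proj₁; proj₂)
open import Data.Sum using (_⊎_; inj₁; inj₂)
open import Data.Bool using (true; false; _∧_; not)
open import Data.Empty using (⊥-elim)
open import Data.List using ([]; _∷_)
open import Data.List.Membership.Propositional using (_∈_)
open import Data.List.Relation.Unary.Any using (here; there)
open import Relation.Nullary using (¬_; Dec; yes; no)
open import Relation.Nullary.Decidable using (map′)
open import Relation.Binary.PropositionalEquality using (_≡_; _≢_; refl; sym; trans)
open import Function.Base using (_∘_)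
open import Function.Bundles using (_⇔_; mk⇔; Equivalence)
open import Axiom.ExcludedMiddle using (ExcludedMiddle)

decide : ExcludedMiddle (Level.suc 0ℓ) → (P : Set) → Dec P
decide em P = map′ lower lift em

≡true⇒≢false : ∀ {x} → x ≡ true → x ≢ false
≡true⇒≢false refl ()

∧-not≡true⇒ : ∀ {x y} → x ∧ not y ≡ true → x ≡ true × y ≡ false
∧-not≡true⇒ {true} {false} refl = refl , refl

∧-not≡true⇐ : ∀ {x y} → x ≡ true → y ≡ false → x ∧ not y ≡ true
∧-not≡true⇐ refl refl = refl

∧-not≡false⇐ : ∀ {x y} → y ≡ true → x ∧ not y ≡ false
∧-not≡false⇐ {true} refl = refl
∧-not≡false⇐ {false} refl = refl

∧-not≡false∧≡true⇒ : ∀ {x y} → x ∧ not y ≡ false → x ≡ true → y ≡ true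
∧-not≡false∧≡true⇒ {true} {true} _ _ = refl

∧-not≡false∧≡false⇒ : ∀ {x y} → x ∧ not y ≡ false → y ≡ false → x ≡ false
∧-not≡false∧≡false⇒ {false} _ _ = refl
∧-not≡false∧≡false⇒ {true} {true} _ ()

module _ {At : Set} where

  private variable
    A B H H′ T T′ I J X Y Z : Interp {At}
    V : HTView {At}
    W : BeliefView {At}
    φ : Formula {At}
    p : PForm {At}
    Γ : Theory {At}
    Π : Program {At}
    U : PairSet {At}
    r : Rule {At}

  ≐-refl : X ≐ X
  ≐-refl _ = refl

  ≐-sym : X ≐ Y → Y ≐ X
  ≐-sym e a = sym (e a)

  ≐-trans : X ≐ Y → Y ≐ Z → X ≐ Z
  ≐-trans e f a = trans (e a) (f a)

  ⊆-refl : X ⊆ X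
  ⊆-refl _ x = x

  ≐⇒⊆ : X ≐ Y → X ⊆ Y
  ≐⇒⊆ e a x = trans (sym (e a)) x

  ⊆-antisym : X ⊆ Y → Y ⊆ X → X ≐ Y
  ⊆-antisym {X} {Y} X⊆Y Y⊆X a with Y a in eq
  ... | true = Y⊆X a eq
  ... | false with X a in eq′
  ...   | true = ⊥-elim (≡true⇒≢false (X⊆Y a eq′) eq)
  ...   | false = refl

  infixl 30 _∖_
  _∖_ : Interp {At} → Interp {At} → Interp {At}
  (I ∖ X) a = I a ∧ not (X a)

  Gap : Interp {At} → Interp {At} → Set
  Gap H T = Σ At λ a → T a ≡ true × H a ≡ false

  ¬Gap⇒⊇ : ¬ Gap H T → T ⊆ H
  ¬Gap⇒⊇ {H} ¬gap a Ta with H a in eq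
  ... | true = refl
  ... | false = ⊥-elim (¬gap (a , Ta , eq))

  ⊆∧≢⇒⊊ : ExcludedMiddle (Level.suc 0ℓ) → H ⊆ T → ¬ H ≐ T → H ⊊ T
  ⊆∧≢⇒⊊ {H} {T} em H⊆T H≢T with decide em (Gap H T)
  ... | yes gap = H⊆T , gap
  ... | no ¬gap = ⊥-elim (H≢T (⊆-antisym H⊆T (¬Gap⇒⊇ ¬gap)))

  satC-resp-≐ : ∀ φ → I ≐ J → satC W I φ → satC W J φ
  satC-resp-≐ ⊥f e ()
  satC-resp-≐ (atom a) e s = trans (sym (e a)) s
  satC-resp-≐ (φ ∧f ψ) e (s , t) = satC-resp-≐ φ e s , satC-resp-≐ ψ e t
  satC-resp-≐ (φ ∨f ψ) e (inj₁ s) = inj₁ (satC-resp-≐ φ e s)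
  satC-resp-≐ (φ ∨f ψ) e (inj₂ s) = inj₂ (satC-resp-≐ ψ e s)
  satC-resp-≐ (φ ⇒f ψ) e s x = satC-resp-≐ ψ e (s (satC-resp-≐ φ (≐-sym e) x))
  satC-resp-≐ (𝐋 φ) e s = s

  satB-resp-≐ : ∀ φ → H ≐ H′ → T ≐ T′ → satB V H T φ → satB V H′ T′ φ
  satB-resp-≐ ⊥f eH eT ()
  satB-resp-≐ (atom a) eH eT s = trans (sym (eH a)) s
  satB-resp-≐ (φ ∧f ψ) eH eT (s , t) = satB-resp-≐ φ eH eT s , satB-resp-≐ ψ eH eT t
  satB-resp-≐ (φ ∨f ψ) eH eT (inj₁ s) = inj₁ (satB-resp-≐ φ eH eT s)
  satB-resp-≐ (φ ∨f ψ) eH eT (inj₂ s) = inj₂ (satB-resp-≐ ψ eH eT s)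
  satB-resp-≐ (φ ⇒f ψ) eH eT (f , g) =
    (λ x → satB-resp-≐ ψ eH eT (f (satB-resp-≐ φ (≐-sym eH) (≐-sym eT) x))) ,
    (λ x → satB-resp-≐ ψ eT eT (g (satB-resp-≐ φ (≐-sym eT) (≐-sym eT) x)))
  satB-resp-≐ (𝐋 φ) eH eT s = s

  _≈ᵛ_ : HTView {At} → HTView {At} → Set
  V ≈ᵛ V′ = (V ⊑V V′) × (V′ ⊑V V)

  ≈ᵛ-refl : V ≈ᵛ V
  ≈ᵛ-refl = (λ H T v → H , T , v , ≐-refl , ≐-refl) , (λ H T v → H , T , v , ≐-refl , ≐-refl)

  tot-resp-≈ᵛ : V ≈ᵛ totalView W → tot V ≈ᵛ totalView W
  proj₁ (tot-resp-≈ᵛ (V⊑W , _)) X Y ((H , v) , X≐Y) =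
    let (_ , T′ , (wT′ , _) , _ , Y≐T′) = V⊑W H Y v
    in T′ , T′ , (wT′ , ≐-refl) , ≐-trans X≐Y Y≐T′ , Y≐T′
  proj₂ (tot-resp-≈ᵛ (_ , W⊑V)) X Y (wY , X≐Y) =
    let (H′ , T′ , v , _ , Y≐T′) = W⊑V X Y (wY , X≐Y)
    in T′ , T′ , ((H′ , v) , ≐-refl) , ≐-trans X≐Y Y≐T′ , Y≐T′

  mutual
    satB⇒satC : V ≈ᵛ totalView W → ∀ φ → H ≐ T → satB V H T φ → satC W T φ
    satB⇒satC V≈W ⊥f e ()
    satB⇒satC V≈W (atom a) e s = trans (sym (e a)) s
    satB⇒satC V≈W (φ ∧f ψ) e (s , t) = satB⇒satC V≈W φ e s , satB⇒satC V≈W ψ e t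
    satB⇒satC V≈W (φ ∨f ψ) e (inj₁ s) = inj₁ (satB⇒satC V≈W φ e s)
    satB⇒satC V≈W (φ ∨f ψ) e (inj₂ s) = inj₂ (satB⇒satC V≈W ψ e s)
    satB⇒satC V≈W (φ ⇒f ψ) e (f , _) x = satB⇒satC V≈W ψ e (f (satC⇒satB V≈W φ e x))
    satB⇒satC V≈W (𝐋 ψ) e s J wJ with proj₂ V≈W J J (wJ , ≐-refl)
    ... | (H′ , T′ , v , J≐H′ , J≐T′) =
      satC-resp-≐ ψ (≐-sym J≐T′) (satB⇒satC V≈W ψ (≐-trans (≐-sym J≐H′) J≐T′) (s H′ T′ v))

    satC⇒satB : V ≈ᵛ totalView W → ∀ φ → H ≐ T → satC W T φ → satB V H T φ
    satC⇒satB V≈W ⊥f e ()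
    satC⇒satB V≈W (atom a) e s = trans (e a) s
    satC⇒satB V≈W (φ ∧f ψ) e (s , t) = satC⇒satB V≈W φ e s , satC⇒satB V≈W ψ e t
    satC⇒satB V≈W (φ ∨f ψ) e (inj₁ s) = inj₁ (satC⇒satB V≈W φ e s)
    satC⇒satB V≈W (φ ∨f ψ) e (inj₂ s) = inj₂ (satC⇒satB V≈W ψ e s)
    satC⇒satB V≈W (φ ⇒f ψ) e s =
      (λ x → satC⇒satB V≈W ψ e (s (satB⇒satC V≈W φ e x))) ,
      (λ x → satC⇒satB (tot-resp-≈ᵛ V≈W) ψ ≐-refl
               (s (satB⇒satC (tot-resp-≈ᵛ V≈W) φ ≐-refl x)))
    satC⇒satB V≈W (𝐋 ψ) e s Hᵢ Tᵢ v with proj₁ V≈W Hᵢ Tᵢ v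
    ... | (X , Y , (wY , X≐Y) , Hᵢ≐X , Tᵢ≐Y) =
      satC⇒satB V≈W ψ (≐-trans Hᵢ≐X (≐-trans X≐Y (≐-sym Tᵢ≐Y)))
        (satC-resp-≐ ψ (≐-sym Tᵢ≐Y) (s Y wY))

  satC⇒satP : IsReduct W φ p → satC W T φ → satP T p
  satP⇒satC : IsReduct W φ p → satP T p → satC W T φ
  satC⇒satP r⊥ ()
  satC⇒satP (rat a) s = s
  satC⇒satP (r∧ r r′) (s , t) = satC⇒satP r s , satC⇒satP r′ t
  satC⇒satP (r∨ r r′) (inj₁ s) = inj₁ (satC⇒satP r s)
  satC⇒satP (r∨ r r′) (inj₂ s) = inj₂ (satC⇒satP r′ s)
  satC⇒satP (r⇒ r r′) s x = satC⇒satP r′ (s (satP⇒satC r x))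
  satC⇒satP (rL⊤ _) _ = λ x → x
  satC⇒satP (rL⊥ ¬w) s = ⊥-elim (¬w s)
  satP⇒satC r⊥ ()
  satP⇒satC (rat a) s = s
  satP⇒satC (r∧ r r′) (s , t) = satP⇒satC r s , satP⇒satC r′ t
  satP⇒satC (r∨ r r′) (inj₁ s) = inj₁ (satP⇒satC r s)
  satP⇒satC (r∨ r r′) (inj₂ s) = inj₂ (satP⇒satC r′ s)
  satP⇒satC (r⇒ r r′) s x = satP⇒satC r′ (s (satC⇒satP r x))
  satP⇒satC (rL⊤ w) _ = w
  satP⇒satC (rL⊥ _) ()

  satB-tot⇒satP : V ≈ᵛ totalView W → IsReduct W φ p → satB (tot V) T T φ → satP T p
  satB-tot⇒satP {φ = φ} V≈W r x = satC⇒satP r (satB⇒satC (tot-resp-≈ᵛ V≈W) φ ≐-refl x)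

  satP⇒satB-tot : V ≈ᵛ totalView W → IsReduct W φ p → satP T p → satB (tot V) T T φ
  satP⇒satB-tot {φ = φ} V≈W r x = satC⇒satB (tot-resp-≈ᵛ V≈W) φ ≐-refl (satP⇒satC r x)

  satB⇒satHT : V ≈ᵛ totalView W → IsReduct W φ p → satB V H T φ → satHT H T p
  satHT⇒satB : V ≈ᵛ totalView W → IsReduct W φ p → satHT H T p → satB V H T φ
  satB⇒satHT V≈W r⊥ ()
  satB⇒satHT V≈W (rat a) s = s
  satB⇒satHT V≈W (r∧ r r′) (s , t) = satB⇒satHT V≈W r s , satB⇒satHT V≈W r′ t
  satB⇒satHT V≈W (r∨ r r′) (inj₁ s) = inj₁ (satB⇒satHT V≈W r s)
  satB⇒satHT V≈W (r∨ r r′) (inj₂ s) = inj₂ (satB⇒satHT V≈W r′ s)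
  satB⇒satHT V≈W (r⇒ r r′) (f , g) =
    (λ x → satB-tot⇒satP V≈W r′ (g (satP⇒satB-tot V≈W r x))) ,
    (λ x → satB⇒satHT V≈W r′ (f (satHT⇒satB V≈W r x)))
  satB⇒satHT V≈W (rL⊤ _) _ = (λ x → x) , (λ x → x)
  satB⇒satHT {T = T} V≈W (rL⊥ {ψ} ¬w) s = ⊥-elim (¬w (satB⇒satC V≈W (𝐋 ψ) (≐-refl {X = T}) s))
  satHT⇒satB V≈W r⊥ ()
  satHT⇒satB V≈W (rat a) s = s
  satHT⇒satB V≈W (r∧ r r′) (s , t) = satHT⇒satB V≈W r s , satHT⇒satB V≈W r′ t
  satHT⇒satB V≈W (r∨ r r′) (inj₁ s) = inj₁ (satHT⇒satB V≈W r s)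
  satHT⇒satB V≈W (r∨ r r′) (inj₂ s) = inj₂ (satHT⇒satB V≈W r′ s)
  satHT⇒satB V≈W (r⇒ r r′) (f , g) =
    (λ x → satHT⇒satB V≈W r′ (g (satB⇒satHT V≈W r x))) ,
    (λ x → satP⇒satB-tot V≈W r′ (f (satB-tot⇒satP V≈W r x)))
  satHT⇒satB {T = T} V≈W (rL⊤ {ψ} w) _ = satC⇒satB V≈W (𝐋 ψ) (≐-refl {X = T}) w
  satHT⇒satB V≈W (rL⊥ _) ()

  reduct-exists : ExcludedMiddle (Level.suc 0ℓ) → ∀ φ → Σ PForm (IsReduct W φ)
  reduct-exists em ⊥f = ⊥p , r⊥
  reduct-exists em (atom a) = patom a , rat a
  reduct-exists em (φ ∧f ψ) = _ , r∧ (proj₂ (reduct-exists em φ)) (proj₂ (reduct-exists em ψ))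
  reduct-exists em (φ ∨f ψ) = _ , r∨ (proj₂ (reduct-exists em φ)) (proj₂ (reduct-exists em ψ))
  reduct-exists em (φ ⇒f ψ) = _ , r⇒ (proj₂ (reduct-exists em φ)) (proj₂ (reduct-exists em ψ))
  reduct-exists {W = W} em (𝐋 ψ) with decide em (W ⊨L ψ)
  ... | yes w = ⊤p , rL⊤ w
  ... | no ¬w = ⊥p , rL⊥ ¬w

  record Refines (V : HTView {At}) (W : BeliefView {At}) : Set where
    field
      here⊆there : V (H , T) → H ⊆ T
      there∈     : V (H , T) → W T
      covers     : W T → Σ Interp λ H → V (H , T)

  Refines⇒tot≈ᵛ : Refines V W → tot V ≈ᵛ totalView W
  Refines⇒tot≈ᵛ ref =
    (λ X Y ((H , v) , X≐Y) → Y , Y , (there∈ v , ≐-refl) , X≐Y , ≐-refl) ,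
    (λ X Y (wY , X≐Y) → Y , Y , (covers wY , ≐-refl) , X≐Y , ≐-refl)
    where open Refines ref

  satB-persistent : Refines V W → ∀ φ → H ⊆ T → satB V H T φ → satC W T φ
  satB-persistent ref ⊥f H⊆T ()
  satB-persistent ref (atom a) H⊆T s = H⊆T a s
  satB-persistent ref (φ ∧f ψ) H⊆T (s , t) = satB-persistent ref φ H⊆T s , satB-persistent ref ψ H⊆T t
  satB-persistent ref (φ ∨f ψ) H⊆T (inj₁ s) = inj₁ (satB-persistent ref φ H⊆T s)
  satB-persistent ref (φ ∨f ψ) H⊆T (inj₂ s) = inj₂ (satB-persistent ref ψ H⊆T s)
  satB-persistent ref (φ ⇒f ψ) H⊆T (_ , g) x =
    satB⇒satC (Refines⇒tot≈ᵛ ref) ψ ≐-refl (g (satC⇒satB (Refines⇒tot≈ᵛ ref) φ ≐-refl x))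
  satB-persistent ref (𝐋 ψ) H⊆T s J wJ =
    let (H , v) = Refines.covers ref wJ
    in satB-persistent ref ψ (Refines.here⊆there ref v) (s H J v)

  satB-¬ : Refines V W → ∀ φ → H ⊆ T → ¬ satC W T φ → satB V H T (¬f φ)
  satB-¬ ref φ H⊆T ¬s =
    (λ x → ¬s (satB-persistent ref φ H⊆T x)) ,
    (λ x → ¬s (satB⇒satC (Refines⇒tot≈ᵛ ref) φ ≐-refl x))

  satB-conj⁻ : ∀ ls → satB V H T (conjF ls) → ∀ {l} → l ∈ ls → satB V H T (litF l)
  satB-conj⁻ (l ∷ []) s (here refl) = s
  satB-conj⁻ (l ∷ _ ∷ _) (s , _) (here refl) = s
  satB-conj⁻ (l ∷ m ∷ ls) (_ , t) (there i) = satB-conj⁻ (m ∷ ls) t i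

  satB-conj⁺ : ∀ ls → (∀ {l} → l ∈ ls → satB V H T (litF l)) → satB V H T (conjF ls)
  satB-conj⁺ [] _ = (λ x → x) , (λ x → x)
  satB-conj⁺ (l ∷ []) s = s (here refl)
  satB-conj⁺ (l ∷ m ∷ ls) s = s (here refl) , satB-conj⁺ (m ∷ ls) (λ i → s (there i))

  satC-conj⁻ : ∀ ls → satC W I (conjF ls) → ∀ {l} → l ∈ ls → satC W I (litF l)
  satC-conj⁻ (l ∷ []) s (here refl) = s
  satC-conj⁻ (l ∷ _ ∷ _) (s , _) (here refl) = s
  satC-conj⁻ (l ∷ m ∷ ls) (_ , t) (there i) = satC-conj⁻ (m ∷ ls) t i

  satB-disj⁻ : ∀ as → satB V H T (disjF as) → Σ At λ a → a ∈ as × H a ≡ true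
  satB-disj⁻ (a ∷ []) s = a , here refl , s
  satB-disj⁻ (a ∷ _ ∷ _) (inj₁ s) = a , here refl , s
  satB-disj⁻ (a ∷ b ∷ as) (inj₂ s) =
    let (c , i , Hc) = satB-disj⁻ (b ∷ as) s in c , there i , Hc

  satB-disj⁺ : ∀ as {a} → a ∈ as → H a ≡ true → satB V H T (disjF as)
  satB-disj⁺ (a ∷ []) (here refl) Ha = Ha
  satB-disj⁺ (a ∷ _ ∷ _) (here refl) Ha = inj₁ Ha
  satB-disj⁺ (a ∷ b ∷ as) (there i) Ha = inj₂ (satB-disj⁺ (b ∷ as) i Ha)

  satC-disj⁻ : ∀ as → satC W I (disjF as) → Σ At λ a → a ∈ as × I a ≡ true
  satC-disj⁻ (a ∷ []) s = a , here refl , s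
  satC-disj⁻ (a ∷ _ ∷ _) (inj₁ s) = a , here refl , s
  satC-disj⁻ (a ∷ b ∷ as) (inj₂ s) =
    let (c , i , Ic) = satC-disj⁻ (b ∷ as) s in c , there i , Ic

  Satisfies : BeliefView {At} → Theory {At} → Set
  Satisfies W Γ = ∀ {J} → W J → ∀ φ → Γ φ → satC W J φ

  totalModel⇒Satisfies : BeliefModel Γ (totalView W) T T → Satisfies W Γ
  totalModel⇒Satisfies bm wJ φ g = satB⇒satC ≈ᵛ-refl φ ≐-refl (proj₁ (bm φ g) _ _ (wJ , ≐-refl))

  SM-reduct⇒satC : ExcludedMiddle (Level.suc 0ℓ) → SM (Reduct Γ W) T → Γ φ → satC W T φ
  SM-reduct⇒satC {φ = φ} em (models , _) g =
    let (p , r) = reduct-exists em φ in satP⇒satC r (models p (φ , g , r))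

  totalBeliefModel : ExcludedMiddle (Level.suc 0ℓ) → Satisfies W Γ → SM (Reduct Γ W) T →
                     BeliefModel Γ (totalView W) T T
  totalBeliefModel em sat sm φ g =
    (λ _ Tᵢ (wTᵢ , e) → satC⇒satB ≈ᵛ-refl φ e (sat wTᵢ φ g)) ,
    satC⇒satB ≈ᵛ-refl φ ≐-refl (SM-reduct⇒satC em sm g)

  totalView-IsHTView : NonEmpty W → IsHTView (totalView W)
  totalView-IsHTView (T , wT) = ((T , T) , wT , ≐-refl) , λ _ _ (_ , e) → ≐⇒⊆ e

  ⊊⇒Prec : H ⊊ T → Prec V H T V T T
  ⊊⇒Prec (H⊆T , a , Ta , Ha) =
    (≐-refl , H⊆T , (λ Hᵢ _ v → Hᵢ , v , ⊆-refl) , (λ Hᵢ _ v → Hᵢ , v , ⊆-refl)) ,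
    λ (_ , _ , H≐T , _) → ≡true⇒≢false (trans (H≐T a) Ta) Ha

  EQB⇒SM : ExcludedMiddle (Level.suc 0ℓ) → NonEmpty W → EQB Γ W T → SM (Reduct Γ W) T
  EQB⇒SM {W = W} {T = T} em ne (bm , minimal) = models , counter-model
    where
    models : ∀ p → Reduct _ W p → satP T p
    models p (φ , g , r) = satC⇒satP r (satB⇒satC ≈ᵛ-refl φ ≐-refl (proj₂ (bm φ g)))
    counter-model : ¬ Σ Interp λ H → H ⊊ T × (∀ p → Reduct _ W p → satHT H T p)
    counter-model (H , H⊊T , H⊨) =
      minimal (totalView W , H , T , totalView-IsHTView ne , proj₁ H⊊T , bm′ , ⊊⇒Prec H⊊T)
      where
      bm′ : BeliefModel _ (totalView W) H T
      bm′ φ g = let (p , r) = reduct-exists em φ in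
        proj₁ (bm φ g) , satHT⇒satB ≈ᵛ-refl r (H⊨ p (φ , g , r))

  Admissible : BeliefView {At} → PairSet {At} → Set
  Admissible W U = ∀ X I → U (X , I) → W I × (Σ At λ a → X a ≡ true × I a ≡ true)

  shrink : BeliefView {At} → PairSet {At} → HTView {At}
  shrink W U (A , B) = totalView W (A , B) ⊎ Σ Interp λ X → U (X , B) × A ≐ B ∖ X

  shrink-refines : Admissible W U → Refines (shrink W U) W
  Refines.here⊆there (shrink-refines adm) (inj₁ (_ , e)) = ≐⇒⊆ e
  Refines.here⊆there (shrink-refines adm) (inj₂ (_ , _ , e)) a x =
    proj₁ (∧-not≡true⇒ (trans (sym (e a)) x))
  Refines.there∈ (shrink-refines adm) (inj₁ (w , _)) = w
  Refines.there∈ (shrink-refines adm) (inj₂ (X , u , _)) = proj₁ (adm X _ u)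
  Refines.covers (shrink-refines adm) w = _ , inj₁ (w , ≐-refl)

  shrink-supports : Admissible W U → U (X , B) → A ≐ B ∖ X → satC W B (ruleF r) →
                    satB (shrink W U) A B (BodyF r) → ¬ satB (shrink W U) A B (HeadF r) →
                    Supports W U r X B
  shrink-supports {W = W} {U = U} {X = X} {B = B} {A = A} {r = r} adm u e rule body⊨ ¬head =
    meets , bodyC , pos-ob , head-out , pos-sub
    where
    bodyC : satC W B (BodyF r)
    bodyC = satB-persistent (shrink-refines adm) (BodyF r)
              (Refines.here⊆there (shrink-refines adm) (inj₂ (X , u , e))) body⊨
    head-false : ∀ {a} → a ∈ head r → A a ≡ false
    head-false {a} i with A a in eq
    ... | true = ⊥-elim (¬head (satB-disj⁺ (head r) i eq))
    ... | false = refl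
    meets : Σ At λ a → a ∈ head r × X a ≡ true
    meets = let (a , i , Ba) = satC-disj⁻ (head r) (rule bodyC) in
      a , i , ∧-not≡false∧≡true⇒ (trans (sym (e a)) (head-false i)) Ba
    pos-ob : ∀ b → b ∈Body⁺ob r → X b ≡ false
    pos-ob b i = proj₂ (∧-not≡true⇒ (trans (sym (e b)) (satB-conj⁻ (body r) body⊨ i)))
    head-out : ∀ a → a ∈ head r → X a ≡ false → B a ≡ false
    head-out a i = ∧-not≡false∧≡false⇒ (trans (sym (e a)) (head-false i))
    pos-sub : ∀ b → b ∈Body⁺sub r → ¬ UnionX U b
    pos-sub b i (X′ , I′ , u′ , X′b) =
      ≡true⇒≢false X′b (proj₂ (∧-not≡true⇒
        (satB-conj⁻ (body r) body⊨ i (I′ ∖ X′) I′ (inj₂ (X′ , u′ , ≐-refl)))))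

  shrink-rule : ExcludedMiddle (Level.suc 0ℓ) → Admissible W U →
                (∀ {B} → W B → satC W B (ruleF r)) →
                (∀ {X I} → U (X , I) → ¬ Supports W U r X I) →
                shrink W U (A , B) → satB (shrink W U) A B (ruleF r)
  shrink-rule {W = W} {U = U} {r = r} {A = A} {B = B} em adm rule unsupported v =
    inPoint v , inTotal
    where
    ref : Refines (shrink W U) W
    ref = shrink-refines adm
    wB : W B
    wB = Refines.there∈ ref v
    inPoint : shrink W U (A , B) → satB (shrink W U) A B (BodyF r) → satB (shrink W U) A B (HeadF r)
    inPoint (inj₁ (_ , A≐B)) x =
      let (a , i , Ba) = satC-disj⁻ (head r)
            (rule wB (satB-persistent ref (BodyF r) (Refines.here⊆there ref v) x))
      in satB-disj⁺ (head r) i (trans (A≐B a) Ba)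
    inPoint (inj₂ (X , u , e)) x with decide em (satB (shrink W U) A B (HeadF r))
    ... | yes h = h
    ... | no ¬h = ⊥-elim (unsupported u (shrink-supports adm u e (rule wB) x ¬h))
    inTotal : satB (tot (shrink W U)) B B (BodyF r) → satB (tot (shrink W U)) B B (HeadF r)
    inTotal x = satC⇒satB (Refines⇒tot≈ᵛ ref) (HeadF r) ≐-refl
                  (rule wB (satB⇒satC (Refines⇒tot≈ᵛ ref) (BodyF r) ≐-refl x))

  shrink-prec : Admissible W U → U (X , I) → Prec (shrink W U) T T (totalView W) T T
  shrink-prec {W = W} {U = U} {X = X} {I = I} adm u =
    (≐-refl , ⊆-refl , (λ Hᵢ _ v → Hᵢ , inj₁ v , ⊆-refl) ,
      (λ _ Tᵢ v → Tᵢ , (Refines.there∈ ref v , ≐-refl) , Refines.here⊆there ref v)) ,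
    ¬same
    where
    ref : Refines (shrink W U) W
    ref = shrink-refines adm
    ¬same : ¬ SameBI (shrink W U) _ _ (totalView W) _ _
    ¬same (shrink⊑W , _) =
      let (H′ , T′ , (_ , H′≐T′) , I∖X≐H′ , I≐T′) = shrink⊑W (I ∖ X) I (inj₂ (X , u , ≐-refl))
          (a , Xa , Ia) = proj₂ (adm X I u)
      in ≡true⇒≢false (trans (I∖X≐H′ a) (trans (H′≐T′ a) (trans (sym (I≐T′ a)) Ia)))
                      (∧-not≡false⇐ Xa)

  EQB⇒Founded : ExcludedMiddle (Level.suc 0ℓ) → Satisfies W (theory Π) → W T →
                EQB (theory Π) W T → Founded Π W
  EQB⇒Founded {W = W} {Π = Π} {T = T} em sat wT (_ , minimal)
              (U , (((_ , _) , u) , unsupported) , adm) =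
    minimal (shrink W U , T , T , isHTView , ⊆-refl , model , shrink-prec adm u)
    where
    ref : Refines (shrink W U) W
    ref = shrink-refines adm
    isHTView : IsHTView (shrink W U)
    isHTView = ((T , T) , inj₁ (wT , ≐-refl)) , λ _ _ → Refines.here⊆there ref
    rule : ∀ {r} → Π r → shrink W U (A , B) → satB (shrink W U) A B (ruleF r)
    rule {r = r} πr = shrink-rule em adm (λ wB → sat wB _ (r , πr , refl))
                        (λ u sup → unsupported _ _ u (r , πr , sup))
    model : BeliefModel (theory Π) (shrink W U) T T
    model _ (r , πr , refl) = (λ _ _ → rule πr) , rule πr (inj₁ (wT , ≐-refl))

  satC⇒satB-lit : Refines V W → H ⊆ T → ∀ l → satC W T (litF l) →
                  (∀ {b} → l ≡ obj (opos b) → H b ≡ true) →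
                  (∀ {b} → l ≡ subpos (opos b) → ∀ Hᵢ Tᵢ → V (Hᵢ , Tᵢ) → Hᵢ b ≡ true) →
                  satB V H T (litF l)
  satC⇒satB-lit ref H⊆T (obj (opos b)) _ atHere _ = atHere refl
  satC⇒satB-lit ref H⊆T (obj (oneg b)) s _ _ = satB-¬ ref (atom b) H⊆T s
  satC⇒satB-lit ref H⊆T (obj (onegneg b)) s _ _ = satB-¬ ref (¬f atom b) H⊆T s
  satC⇒satB-lit ref H⊆T (subpos (opos b)) _ _ atAll = atAll refl
  satC⇒satB-lit ref H⊆T (subpos (oneg b)) s _ _ _ Tᵢ v =
    satB-¬ ref (atom b) (Refines.here⊆there ref v) (s Tᵢ (Refines.there∈ ref v))
  satC⇒satB-lit ref H⊆T (subpos (onegneg b)) s _ _ _ Tᵢ v =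
    satB-¬ ref (¬f atom b) (Refines.here⊆there ref v) (s Tᵢ (Refines.there∈ ref v))
  satC⇒satB-lit ref H⊆T (subneg l) s _ _ = satB-¬ ref (𝐋 (objF l)) H⊆T s
  satC⇒satB-lit ref H⊆T (subnegneg l) s _ _ = satB-¬ ref (¬f 𝐋 (objF l)) H⊆T s

  gaps : HTView {At} → PairSet {At}
  gaps V (X , I) = Σ Interp λ Hᵢ → V (Hᵢ , I) × X ≐ I ∖ Hᵢ × Gap Hᵢ I

  gaps-admissible : Refines V W → Admissible W (gaps V)
  gaps-admissible ref X I (_ , v , e , a , Ia , Hᵢa) =
    Refines.there∈ ref v , a , trans (e a) (∧-not≡true⇐ Ia Hᵢa) , Ia

  gaps-unsupported : Refines V W → (∀ {Hᵢ Tᵢ} → V (Hᵢ , Tᵢ) → satB V Hᵢ Tᵢ (ruleF r)) →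
                     gaps V (X , I) → ¬ Supports W (gaps V) r X I
  gaps-unsupported {V = V} {W = W} {r = r} {X = X} {I = I} ref rule (Hᵢ , v , e , _)
                   (_ , bodyC , pos-ob , head-out , pos-sub) =
    let (c , i , Hᵢc) = satB-disj⁻ (head r) (proj₁ (rule v) (satB-conj⁺ (body r) lit))
    in ≡true⇒≢false (Refines.here⊆there ref v c Hᵢc)
                    (head-out c i (trans (e c) (∧-not≡false⇐ Hᵢc)))
    where
    atHere : ∀ {b} → b ∈Body⁺ob r → Hᵢ b ≡ true
    atHere {b} i = ∧-not≡false∧≡true⇒ (trans (sym (e b)) (pos-ob b i)) (satC-conj⁻ (body r) bodyC i)
    atAll : ∀ {b} → b ∈Body⁺sub r → ∀ Hⱼ Tⱼ → V (Hⱼ , Tⱼ) → Hⱼ b ≡ true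
    atAll {b} i Hⱼ Tⱼ vⱼ with Hⱼ b in eq
    ... | true = refl
    ... | false =
      let Tⱼb = satC-conj⁻ (body r) bodyC i Tⱼ (Refines.there∈ ref vⱼ)
      in ⊥-elim (pos-sub b i (Tⱼ ∖ Hⱼ , Tⱼ , (Hⱼ , vⱼ , ≐-refl , b , Tⱼb , eq) , ∧-not≡true⇐ Tⱼb eq))
    lit : ∀ {l} → l ∈ body r → satB V Hᵢ I (litF l)
    lit {l} i = satC⇒satB-lit ref (Refines.here⊆there ref v) l (satC-conj⁻ (body r) bodyC i)
                  (λ { refl → atHere i }) (λ { refl → atAll i })

  nonTotal⇒Unfounded : Refines V W →
                       (∀ {r} → Π r → ∀ {Hᵢ Tᵢ} → V (Hᵢ , Tᵢ) → satB V Hᵢ Tᵢ (ruleF r)) →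
                       V (H , T) → Gap H T → Unfounded Π W
  nonTotal⇒Unfounded {V = V} {H = H} {T = T} ref rules v gap =
    gaps V ,
    (((T ∖ H , T) , H , v , ≐-refl , gap) ,
     λ _ _ g (_ , πr , sup) → gaps-unsupported ref (rules πr) g sup) ,
    gaps-admissible ref

  allTotal⇒≈ᵛ : Refines V W → (∀ {H T} → V (H , T) → ¬ Gap H T) → V ≈ᵛ totalView W
  allTotal⇒≈ᵛ {V = V} ref total =
    (λ _ T v → T , T , (Refines.there∈ ref v , ≐-refl) , total⇒≐ v , ≐-refl) ,
    (λ X Y (wY , X≐Y) → let (H , v) = Refines.covers ref wY in
       H , Y , v , ≐-trans X≐Y (≐-sym (total⇒≐ v)) , ≐-refl)
    where
    total⇒≐ : ∀ {H T} → V (H , T) → H ≐ T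
    total⇒≐ v = ⊆-antisym (Refines.here⊆there ref v) (¬Gap⇒⊇ (total v))

  Preceq-total⇒Refines : IsHTView V → Preceq V H T (totalView W) I I → Refines V W
  Refines.here⊆there (Preceq-total⇒Refines (_ , sub) _) = sub _ _
  Refines.there∈ (Preceq-total⇒Refines _ (_ , _ , _ , below)) v = proj₁ (proj₁ (proj₂ (below _ _ v)))
  Refines.covers (Preceq-total⇒Refines _ (_ , _ , above , _)) wT =
    let (H , v , _) = above _ _ (wT , ≐-refl) in H , v

  SM∧Founded⇒EQB : ExcludedMiddle (Level.suc 0ℓ) → Satisfies W (theory Π) →
                   SM (Reduct (theory Π) W) T → Founded Π W → EQB (theory Π) W T
  SM∧Founded⇒EQB {W = W} {Π = Π} {T = T} em sat sm founded = totalBeliefModel em sat sm , minimal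
    where
    minimal : ¬ (Σ HTView λ V → Σ Interp λ H′ → Σ Interp λ T′ →
                 IsHTView V × H′ ⊆ T′ × BeliefModel (theory Π) V H′ T′ ×
                 Prec V H′ T′ (totalView W) T T)
    minimal (V , H′ , T′ , isHT , _ , model , prec@(T′≐T , H′⊆T , _) , ¬same)
      with decide em (Σ Interp λ Hᵢ → Σ Interp λ Tᵢ → V (Hᵢ , Tᵢ) × Gap Hᵢ Tᵢ)
    ... | yes (_ , _ , v , gap) =
      founded (nonTotal⇒Unfounded (Preceq-total⇒Refines isHT prec)
                 (λ {r} πr v → proj₁ (model _ (r , πr , refl)) _ _ v) v gap)
    ... | no ¬gap =
      proj₂ sm (H′ , ⊆∧≢⇒⊊ em H′⊆T (λ H′≐T → ¬same (proj₁ V≈W , proj₂ V≈W , H′≐T , T′≐T)) ,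
                λ _ (φ , g , r) → satB⇒satHT V≈W r (satB-resp-≐ φ ≐-refl T′≐T (proj₂ (model φ g))))
      where
      V≈W : V ≈ᵛ totalView W
      V≈W = allTotal⇒≈ᵛ (Preceq-total⇒Refines isHT prec) (λ v gap → ¬gap (_ , _ , v , gap))

mainTheorem1 : ExcludedMiddle (Level.suc 0ℓ) →
    {At : Set} (Π : Program {At}) → WellFormed Π →
    (W : BeliefView {At}) → NonEmpty W →
    EquilibriumWorldView (theory Π) W ⇔ (G91WorldView (theory Π) W × Founded Π W)
mainTheorem1 em Π _ W ne@(T₀ , w₀) = mk⇔ equilibrium⇒ ⇒equilibrium
  where
  open Equivalence
  equilibrium⇒ : EquilibriumWorldView (theory Π) W → G91WorldView (theory Π) W × Founded Π W
  equilibrium⇒ ewv = g91 , founded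
    where
    sat : Satisfies W (theory Π)
    sat = totalModel⇒Satisfies (proj₁ (to (ewv T₀) w₀))
    founded : Founded Π W
    founded = EQB⇒Founded em sat w₀ (to (ewv T₀) w₀)
    g91 : G91WorldView (theory Π) W
    g91 T = mk⇔ (EQB⇒SM em ne ∘ to (ewv T))
                (λ sm → from (ewv T) (SM∧Founded⇒EQB em sat sm founded))
  ⇒equilibrium : G91WorldView (theory Π) W × Founded Π W → EquilibriumWorldView (theory Π) W
  ⇒equilibrium (g91 , founded) T =
    mk⇔ (λ w → SM∧Founded⇒EQB em sat (to (g91 T) w) founded) (from (g91 T) ∘ EQB⇒SM em ne)
    where
    sat : Satisfies W (theory Π)
    sat {J} wJ _ = SM-reduct⇒satC em (to (g91 J) wJ)
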